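{- For a positive integer $n$, let $G(n)$ denote the number of permutations $\sigma$ of $[n]=\{1,\dots,n\}$ that are not locally disjoint from the identity permutation. Then $G(n)\le 5^n$.
   Context: A permutation of $[n]$ is a bijection $[n]\to[n]$; for a permutation $\sigma$ and $a\in[n]$, $\sigma^{ -1}(a)$ is the position of $a$ when $\sigma$ is viewed as the linear order $\sigma(1),\dots,\sigma(n)$. Two permutations $\sigma,\tau$ of $[n]$ are called locally disjoint if there exist two distinct elements $a,b\in[n]$ such that $\sigma^{ -1}(a)<\sigma^{ -1}(b)<\tau^{ -1}(a)<\tau^{ -1}(b)$ or $\tau^{ -1}(a)<\tau^{ -1}(b)<\sigma^{ -1}(a)<\sigma^{ -1}(b)$. -}

module Defs where

open import Data.Nat using (ℕ)
open import Data.Fin using (Fin; _<_)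
open import Data.Fin.Permutation using (Permutation′; _⟨$⟩ˡ_; id)
open import Data.Product using (∃₂; _×_)
open import Data.Sum using (_⊎_)
open import Data.List using (List)
open import Data.List.Relation.Unary.All using (All)
open import Data.List.Relation.Unary.AllPairs using (AllPairs)
open import Relation.Binary.PropositionalEquality using (_≡_; _≢_)
open import Relation.Nullary using (¬_)

-- Elements of [n] are represented by Fin n (0-based; order is preserved).
-- σ ⟨$⟩ˡ a  is σ⁻¹(a), the position of a in σ.

LocallyDisjoint : ∀ {n} → Permutation′ n → Permutation′ n → Set
LocallyDisjoint {n} σ τ = ∃₂ λ (a b : Fin n) → (a ≢ b) ×
  ( ((σ ⟨$⟩ˡ a) < (σ ⟨$⟩ˡ b) × (σ ⟨$⟩ˡ b) < (τ ⟨$⟩ˡ a) × (τ ⟨$⟩ˡ a) < (τ ⟨$⟩ˡ b))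
  ⊎ ((τ ⟨$⟩ˡ a) < (τ ⟨$⟩ˡ b) × (τ ⟨$⟩ˡ b) < (σ ⟨$⟩ˡ a) × (σ ⟨$⟩ˡ a) < (σ ⟨$⟩ˡ b)))

_≐_ : ∀ {n} → Permutation′ n → Permutation′ n → Set
_≐_ {n} σ τ = ∀ (a : Fin n) → σ ⟨$⟩ˡ a ≡ τ ⟨$⟩ˡ a

Distinct : ∀ {n} → List (Permutation′ n) → Set
Distinct = AllPairs (λ σ τ → ¬ (σ ≐ τ))

AllNotLDFromId : ∀ {n} → List (Permutation′ n) → Set
AllNotLDFromId {n} = All (λ σ → ¬ LocallyDisjoint σ (id {n}))

-- Record, for each i, how σ⁻¹(i) and σ(i) compare with i. As σ⁻¹(i) = i iff σ(i) = i, only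
-- five of the nine combinations occur, so there are at most 5ⁿ records, and it suffices that a
-- permutation not locally disjoint from the identity is determined by its record.
-- Let σ, τ be two such permutations with the same record, and a minimal with σ⁻¹(a) < a and
-- σ⁻¹(a) ≠ τ⁻¹(a), say σ⁻¹(a) < τ⁻¹(a) = j′ < a. Then b = σ(j′) > j′ because τ(j′) = a > j′.
-- If b < a, minimality gives τ⁻¹(b) = σ⁻¹(b) = j′ = τ⁻¹(a); b = a is impossible; and b > a
-- yields σ⁻¹(a) < σ⁻¹(b) < a < b, a local disjointness. Elements with σ⁻¹(a) > a are handled by
-- the same argument for the reversed order, and σ, τ have the same fixed points.

module Submission where

open import Defs
open import Data.Nat using (ℕ; _≤_; _^_; NonZero; s≤s)
open import Data.List using (List; length)
open import Data.Fin.Permutation using (Permutation′)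

open import Level using (0ℓ)
open import Data.Nat.Properties using (≮⇒≥)
open import Data.Fin using (Fin; _<_; _>_; zero; suc; funToFin; finToFun)
open import Data.Fin.Properties using (<-cmp; <⇒≢; pigeonhole; finToFun-funToFin)
open import Data.Fin.Patterns using (0F; 1F; 2F; 3F; 4F)
open import Data.Fin.Induction using (<-wellFounded; >-wellFounded)
open import Data.Fin.Permutation using (_⟨$⟩ʳ_; _⟨$⟩ˡ_; inverseˡ; inverseʳ; id)
open import Data.Product using (_×_; _,_; ∃₂; proj₁; proj₂)
open import Data.Sum using (_⊎_; inj₁; inj₂)
open import Data.Empty using (⊥-elim)
import Data.List as List
import Data.List.Relation.Unary.All as All
open import Data.List.Relation.Unary.All using (All)
open import Data.List.Relation.Unary.AllPairs using (AllPairs; _∷_)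
open import Data.List.Membership.Propositional.Properties using (∈-lookup)
open import Function using (_∘_; _⇔_; mk⇔; Equivalence)
import Function.Properties.Equivalence as ⇔
open import Induction.WellFounded using (WellFounded; Acc; acc)
open import Relation.Binary using (Rel; Trichotomous; Tri; tri<; tri≈; tri>)
open import Relation.Binary.Consequences using (tri⇒irr)
import Relation.Binary.Construct.Flip.EqAndOrd as Flip
open import Relation.Binary.PropositionalEquality
open import Relation.Nullary using (¬_)

⟨$⟩ˡ-injective : ∀ {n} (σ : Permutation′ n) {a b} → σ ⟨$⟩ˡ a ≡ σ ⟨$⟩ˡ b → a ≡ b
⟨$⟩ˡ-injective σ {a} {b} eq = begin
  a                       ≡⟨ inverseʳ σ ⟨
  σ ⟨$⟩ʳ (σ ⟨$⟩ˡ a)        ≡⟨ cong (σ ⟨$⟩ʳ_) eq ⟩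
  σ ⟨$⟩ʳ (σ ⟨$⟩ˡ b)        ≡⟨ inverseʳ σ ⟩
  b                       ∎
  where open ≡-Reasoning

module _ {n : ℕ} (_≺_ : Rel (Fin n) 0ℓ) where

  Crossing : Permutation′ n → Set
  Crossing σ = ∃₂ λ a b → (σ ⟨$⟩ˡ a) ≺ (σ ⟨$⟩ˡ b) × (σ ⟨$⟩ˡ b) ≺ a × a ≺ b

  record SameExcedances (σ τ : Permutation′ n) : Set where
    field
      positions : ∀ i → i ≺ (σ ⟨$⟩ʳ i) → i ≺ (τ ⟨$⟩ʳ i)
      values    : ∀ a → (σ ⟨$⟩ˡ a) ≺ a → (τ ⟨$⟩ˡ a) ≺ a

  open SameExcedances

  module _ (compare : Trichotomous _≡_ _≺_) where

    excedance-value-not-earlier : ∀ σ τ → ¬ Crossing σ → SameExcedances σ τ → SameExcedances τ σ →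
      ∀ {a} → (∀ {b} → b ≺ a → (σ ⟨$⟩ˡ b) ≺ b → σ ⟨$⟩ˡ b ≡ τ ⟨$⟩ˡ b) →
      (σ ⟨$⟩ˡ a) ≺ a → ¬ ((σ ⟨$⟩ˡ a) ≺ (τ ⟨$⟩ˡ a))
    excedance-value-not-earlier σ τ noCrossing στ τσ {a} ih a-exc j≺j′ = refute (compare b a)
      where
      j′ = τ ⟨$⟩ˡ a
      b  = σ ⟨$⟩ʳ j′
      j′≺a : j′ ≺ a
      j′≺a = values στ a a-exc
      j′≺b : j′ ≺ b
      j′≺b = positions τσ j′ (subst (j′ ≺_) (sym (inverseʳ τ)) j′≺a)
      σ⁻¹b≡j′ : σ ⟨$⟩ˡ b ≡ j′
      σ⁻¹b≡j′ = inverseˡ σ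
      refute : ¬ Tri (b ≺ a) (b ≡ a) (a ≺ b)
      refute (tri< b≺a b≢a _) =
        b≢a (⟨$⟩ˡ-injective τ (trans (sym (ih b≺a (subst (_≺ b) (sym σ⁻¹b≡j′) j′≺b))) σ⁻¹b≡j′))
      refute (tri≈ _ b≡a _) =
        tri⇒irr compare (trans (cong (σ ⟨$⟩ˡ_) (sym b≡a)) σ⁻¹b≡j′) j≺j′
      refute (tri> _ _ a≺b) =
        noCrossing (a , b , subst ((σ ⟨$⟩ˡ a) ≺_) (sym σ⁻¹b≡j′) j≺j′ ,
                    subst (_≺ a) (sym σ⁻¹b≡j′) j′≺a , a≺b)

    excedance-values-agree : WellFounded _≺_ → ∀ σ τ → ¬ Crossing σ → ¬ Crossing τ →
      SameExcedances σ τ → SameExcedances τ σ →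
      ∀ a → (σ ⟨$⟩ˡ a) ≺ a → σ ⟨$⟩ˡ a ≡ τ ⟨$⟩ˡ a
    excedance-values-agree wf σ τ noCrossingσ noCrossingτ στ τσ a = go (wf a)
      where
      go : ∀ {a} → Acc _≺_ a → (σ ⟨$⟩ˡ a) ≺ a → σ ⟨$⟩ˡ a ≡ τ ⟨$⟩ˡ a
      go {a} (acc rs) a-exc = decide (compare (σ ⟨$⟩ˡ a) (τ ⟨$⟩ˡ a))
        where
        ih : ∀ {b} → b ≺ a → (σ ⟨$⟩ˡ b) ≺ b → σ ⟨$⟩ˡ b ≡ τ ⟨$⟩ˡ b
        ih b≺a = go (rs b≺a)
        decide : Tri ((σ ⟨$⟩ˡ a) ≺ (τ ⟨$⟩ˡ a)) (σ ⟨$⟩ˡ a ≡ τ ⟨$⟩ˡ a) ((τ ⟨$⟩ˡ a) ≺ (σ ⟨$⟩ˡ a)) →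
          σ ⟨$⟩ˡ a ≡ τ ⟨$⟩ˡ a
        decide (tri< σ≺τ _ _) =
          ⊥-elim (excedance-value-not-earlier σ τ noCrossingσ στ τσ ih a-exc σ≺τ)
        decide (tri≈ _ σ≡τ _) = σ≡τ
        decide (tri> _ _ τ≺σ) =
          ⊥-elim (excedance-value-not-earlier τ σ noCrossingτ τσ στ
            (λ b≺a b-exc → sym (ih b≺a (values τσ _ b-exc))) (values στ a a-exc) τ≺σ)

data Comparison : Set where
  less equal greater : Comparison

module _ {A B C : Set} where

  toComparison : Tri A B C → Comparison
  toComparison (tri< _ _ _) = less
  toComparison (tri≈ _ _ _) = equal
  toComparison (tri> _ _ _) = greater

  toComparison≡less⇔ : (t : Tri A B C) → toComparison t ≡ less ⇔ A
  toComparison≡less⇔ (tri< a _ _)  = mk⇔ (λ _ → a) (λ _ → refl)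
  toComparison≡less⇔ (tri≈ ¬a _ _) = mk⇔ (λ ()) (λ a → ⊥-elim (¬a a))
  toComparison≡less⇔ (tri> ¬a _ _) = mk⇔ (λ ()) (λ a → ⊥-elim (¬a a))

  toComparison≡equal⇔ : (t : Tri A B C) → toComparison t ≡ equal ⇔ B
  toComparison≡equal⇔ (tri< _ ¬b _) = mk⇔ (λ ()) (λ b → ⊥-elim (¬b b))
  toComparison≡equal⇔ (tri≈ _ b _)  = mk⇔ (λ _ → b) (λ _ → refl)
  toComparison≡equal⇔ (tri> _ ¬b _) = mk⇔ (λ ()) (λ b → ⊥-elim (¬b b))

  toComparison≡greater⇔ : (t : Tri A B C) → toComparison t ≡ greater ⇔ C
  toComparison≡greater⇔ (tri< _ _ ¬c) = mk⇔ (λ ()) (λ c → ⊥-elim (¬c c))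
  toComparison≡greater⇔ (tri≈ _ _ ¬c) = mk⇔ (λ ()) (λ c → ⊥-elim (¬c c))
  toComparison≡greater⇔ (tri> _ _ c)  = mk⇔ (λ _ → c) (λ _ → refl)

transfer : ∀ {x y c : Comparison} {P Q : Set} → x ≡ c ⇔ P → y ≡ c ⇔ Q → x ≡ y → P → Q
transfer x≡c⇔P y≡c⇔Q x≡y p = Equivalence.to y≡c⇔Q (trans (sym x≡y) (Equivalence.from x≡c⇔P p))

Consistent : Comparison × Comparison → Set
Consistent (c , d) = c ≡ equal ⇔ d ≡ equal

encode : Comparison × Comparison → Fin 5
encode (less    , less) = 0F
encode (less    , _)    = 1F
encode (greater , less) = 2F
encode (greater , _)    = 3F
encode (equal   , _)    = 4F

decode : Fin 5 → Comparison × Comparison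
decode 0F = less    , less
decode 1F = less    , greater
decode 2F = greater , less
decode 3F = greater , greater
decode 4F = equal   , equal

decode-encode : ∀ {p} → Consistent p → decode (encode p) ≡ p
decode-encode {less    , less}    _ = refl
decode-encode {less    , greater} _ = refl
decode-encode {greater , less}    _ = refl
decode-encode {greater , greater} _ = refl
decode-encode {equal   , d}       c⇔d = cong (equal ,_) (sym (Equivalence.to c⇔d refl))
decode-encode {less    , equal}   c⇔d with () ← Equivalence.from c⇔d refl
decode-encode {greater , equal}   c⇔d with () ← Equivalence.from c⇔d refl

module _ {n : ℕ} where

  comparison : Fin n → Fin n → Comparison
  comparison a b = toComparison (<-cmp a b)

  shape : Permutation′ n → Fin n → Comparison × Comparison
  shape σ i = comparison (σ ⟨$⟩ˡ i) i , comparison i (σ ⟨$⟩ʳ i)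

  code : Permutation′ n → Fin n → Fin 5
  code σ i = encode (shape σ i)

  fixed⇔ : ∀ (σ : Permutation′ n) {i} → σ ⟨$⟩ˡ i ≡ i ⇔ i ≡ σ ⟨$⟩ʳ i
  fixed⇔ σ = mk⇔ (λ e → trans (sym (inverseʳ σ)) (cong (σ ⟨$⟩ʳ_) e))
                 (λ e → trans (cong (σ ⟨$⟩ˡ_) e) (inverseˡ σ))

  shape-consistent : ∀ σ i → Consistent (shape σ i)
  shape-consistent σ i =
    ⇔.trans (toComparison≡equal⇔ (<-cmp (σ ⟨$⟩ˡ i) i))
      (⇔.trans (fixed⇔ σ) (⇔.sym (toComparison≡equal⇔ (<-cmp i (σ ⟨$⟩ʳ i)))))

  sameCode⇒sameShape : ∀ σ τ → code σ ≗ code τ → shape σ ≗ shape τ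
  sameCode⇒sameShape σ τ same i = begin
    shape σ i                 ≡⟨ decode-encode (shape-consistent σ i) ⟨
    decode (code σ i)         ≡⟨ cong decode (same i) ⟩
    decode (code τ i)         ≡⟨ decode-encode (shape-consistent τ i) ⟩
    shape τ i                 ∎
    where open ≡-Reasoning

  sameShape⇒sameExcedances< : ∀ {σ τ} → shape σ ≗ shape τ → SameExcedances _<_ σ τ
  sameShape⇒sameExcedances< {σ} {τ} same = record
    { positions = λ i → transfer (toComparison≡less⇔ (<-cmp i (σ ⟨$⟩ʳ i)))
                                 (toComparison≡less⇔ (<-cmp i (τ ⟨$⟩ʳ i))) (cong proj₂ (same i))
    ; values    = λ a → transfer (toComparison≡less⇔ (<-cmp (σ ⟨$⟩ˡ a) a))
                                 (toComparison≡less⇔ (<-cmp (τ ⟨$⟩ˡ a) a)) (cong proj₁ (same a))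
    }

  sameShape⇒sameExcedances> : ∀ {σ τ} → shape σ ≗ shape τ → SameExcedances _>_ σ τ
  sameShape⇒sameExcedances> {σ} {τ} same = record
    { positions = λ i → transfer (toComparison≡greater⇔ (<-cmp i (σ ⟨$⟩ʳ i)))
                                 (toComparison≡greater⇔ (<-cmp i (τ ⟨$⟩ʳ i))) (cong proj₂ (same i))
    ; values    = λ a → transfer (toComparison≡greater⇔ (<-cmp (σ ⟨$⟩ˡ a) a))
                                 (toComparison≡greater⇔ (<-cmp (τ ⟨$⟩ˡ a) a)) (cong proj₁ (same a))
    }

  crossing⇒locallyDisjoint : ∀ σ → Crossing _<_ σ ⊎ Crossing _>_ σ → LocallyDisjoint σ (id {n})
  crossing⇒locallyDisjoint _ (inj₁ (a , b , σa<σb , σb<a , a<b)) =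
    a , b , <⇒≢ a<b , inj₁ (σa<σb , σb<a , a<b)
  crossing⇒locallyDisjoint _ (inj₂ (a , b , σa>σb , σb>a , a>b)) =
    b , a , <⇒≢ a>b , inj₂ (a>b , σb>a , σa>σb)

  sameCode⇒≐ : ∀ σ τ → ¬ LocallyDisjoint σ (id {n}) → ¬ LocallyDisjoint τ (id {n}) →
    code σ ≗ code τ → σ ≐ τ
  sameCode⇒≐ σ τ ¬ldσ ¬ldτ sameCode a = agree (<-cmp (σ ⟨$⟩ˡ a) a)
    where
    same : shape σ ≗ shape τ
    same = sameCode⇒sameShape σ τ sameCode
    agree : Tri ((σ ⟨$⟩ˡ a) < a) (σ ⟨$⟩ˡ a ≡ a) ((σ ⟨$⟩ˡ a) > a) → σ ⟨$⟩ˡ a ≡ τ ⟨$⟩ˡ a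
    agree (tri< σa<a _ _) =
      excedance-values-agree _<_ <-cmp <-wellFounded σ τ
      (¬ldσ ∘ crossing⇒locallyDisjoint σ ∘ inj₁) (¬ldτ ∘ crossing⇒locallyDisjoint τ ∘ inj₁)
      (sameShape⇒sameExcedances< same) (sameShape⇒sameExcedances< (sym ∘ same)) a σa<a
    agree (tri> _ _ σa>a) =
      excedance-values-agree _>_ (Flip.compare _<_ <-cmp) >-wellFounded σ τ
      (¬ldσ ∘ crossing⇒locallyDisjoint σ ∘ inj₂) (¬ldτ ∘ crossing⇒locallyDisjoint τ ∘ inj₂)
      (sameShape⇒sameExcedances> same) (sameShape⇒sameExcedances> (sym ∘ same)) a σa>a
    agree (tri≈ _ σa≡a _) =
      trans σa≡a (sym (transfer (toComparison≡equal⇔ (<-cmp (σ ⟨$⟩ˡ a) a))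
                                (toComparison≡equal⇔ (<-cmp (τ ⟨$⟩ˡ a) a))
                                (cong proj₁ (same a)) σa≡a))

funToFin-injective : ∀ {m k} {f g : Fin m → Fin k} → funToFin f ≡ funToFin g → f ≗ g
funToFin-injective {f = f} {g} eq i = begin
  f i                        ≡⟨ finToFun-funToFin f i ⟨
  finToFun (funToFin f) i    ≡⟨ cong (λ x → finToFun x i) eq ⟩
  finToFun (funToFin g) i    ≡⟨ finToFun-funToFin g i ⟩
  g i                        ∎
  where open ≡-Reasoning

allPairs-lookup : ∀ {A : Set} {R : Rel A 0ℓ} {xs : List A} → AllPairs R xs →
  ∀ {i j} → i < j → R (List.lookup xs i) (List.lookup xs j)
allPairs-lookup (Rx ∷ _)  {zero}  {suc j} _         = All.lookup Rx (∈-lookup j)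
allPairs-lookup (_ ∷ Rxs) {suc i} {suc j} (s≤s i<j) = allPairs-lookup Rxs i<j

lemma1 : (n : ℕ) → .{{_ : NonZero n}} → (L : List (Permutation′ n)) →
    Distinct L → AllNotLDFromId L → length L ≤ 5 ^ n
lemma1 n L distinct notLD = ≮⇒≥ λ 5ⁿ<∣L∣ →
  let i , j , i<j , sameCode = pigeonhole 5ⁿ<∣L∣ (funToFin ∘ code ∘ List.lookup L)
  in allPairs-lookup distinct i<j
       (sameCode⇒≐ (List.lookup L i) (List.lookup L j)
         (All.lookup notLD (∈-lookup i)) (All.lookup notLD (∈-lookup j))
         (funToFin-injective sameCode))
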